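{- Let $p\ge1$, let $r_1,\dots,r_p$ be nonnegative integers, $\mathbf r_p=(r_1,\dots,r_p)$, $|\mathbf r_p|=r_1+\cdots+r_p$, and let $n,k$ be nonnegative integers with $n\geq|\mathbf r_p|$. Fix $i\in\{1,\dots,p\}$ with $r_i\geq1$. Then \[ {n \brace k}_{\!\mathbf r_p}={n-1 \brace k-1}_{\!\mathbf r_p-\mathbf e_i}+(k+1-r_i){n-1 \brace k}_{\!\mathbf r_p-\mathbf e_i}, \] where $\mathbf e_i$ is the $i$-th standard basis vector of $\mathbb R^p$.
   Context: For nonnegative integers $r_1,\dots,r_p$ and $N$, let $R_1,\dots,R_p$ be pairwise disjoint subsets of $\{1,\dots,N\}$ with $|R_i|=r_i$; the $(r_1,\dots,r_p)$-Stirling number of the second kind ${N \brace k}_{r_1,\dots,r_p}$ is the number of partitions of $\{1,\dots,N\}$ into $k$ nonempty blocks such that, for each $i$, the elements of $R_i$ lie in distinct blocks (independent of the choice of the $R_i$; zero if $N<r_1+\cdots+r_p$). Stirling numbers with negative lower index are $0$. -}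

module Defs where

open import Data.Bool using (Bool; true; false; _∧_; not; if_then_else_)
open import Data.Nat using (ℕ; zero; suc; _+_; _<ᵇ_; _≡ᵇ_; _≤ᵇ_)
open import Data.List using (List; []; _∷_; length; filterᵇ; concatMap; take; drop)
open import Data.Bool.ListAction using (any)
open import Data.Vec using (Vec; []; _∷_)
import Data.Vec as V

labellings : ℕ → ℕ → List (List ℕ)
labellings k zero    = [] ∷ []
labellings k (suc N) = concatMap (λ x → Data.List.map (x ∷_) (labellings k N)) (Data.List.upTo k)

-- Restricted growth strings: a labelling encodes a set partition into exactly k nonempty
-- blocks, with blocks numbered 0,1,…,k-1 in order of their least elements
-- (the standard canonical representative of a set partition). The argument m is the
-- number of blocks opened so far.
rgs : ℕ → ℕ → List ℕ → Bool
rgs k m []       = m ≡ᵇ k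
rgs k m (x ∷ xs) = if x <ᵇ m then rgs k m xs else (if x ≡ᵇ m then rgs k (suc m) xs else false)

distinct : List ℕ → Bool
distinct []       = true
distinct (x ∷ xs) = not (any (λ y → x ≡ᵇ y) xs) ∧ distinct xs

-- The restricted sets are fixed canonically as consecutive ranges:
-- R_1 = {1..r_1}, R_2 = {r_1+1..r_1+r_2}, …  (the number does not depend on the choice).
-- restrOK r l: for every i, the elements of R_i get pairwise distinct block labels.
restrOK : ∀ {p} → Vec ℕ p → List ℕ → Bool
restrOK []       l = true
restrOK (r ∷ rs) l = distinct (take r l) ∧ restrOK rs (drop r l)

stirlingR : ∀ {p} → Vec ℕ p → ℕ → ℕ → ℕ
stirlingR r N k =
  if V.sum r ≤ᵇ N
  then length (filterᵇ (λ l → rgs k 0 l ∧ restrOK r l) (labellings k N))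
  else 0

-- case-k k f = f (k-1) if k ≥ 1, and 0 if k = 0 (Stirling numbers with negative
-- lower index are 0).
case-k : ℕ → (ℕ → ℕ) → ℕ
case-k zero    f = 0
case-k (suc k) f = f k

-- Read a labelling of {1,…,N} from left to right.  When an element arrives and
-- m blocks are already open, it either opens block m or joins one of the open blocks
-- other than the a blocks already used by the earlier members of its restricted group.
-- Writing the list of these "forbidden counts" a₁,…,a_N (0,1,…,rⱼ-1 along the group Rⱼ,
-- then 0 for unrestricted elements) gives the recurrence
--   W (a ∷ as) m k = W as (m+1) k + (m - a) · W as m k
-- for the number W of completions with exactly k blocks.  Over ℤ this W is invariant
-- under permuting the list (a polynomial identity), and appending a last entry a gives
--   W (xs ++ [a]) 0 k = W xs 0 (k-1) + (k - a) · W xs 0 k.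
-- Moving the last member of Rᵢ (forbidden count rᵢ-1) to the end of the list therefore
-- yields the theorem.
module Submission where

open import Defs
open import Data.Bool using (Bool; true; false; _∧_; _∨_; not; if_then_else_; T)
open import Data.Bool.Properties using (T-≡; ∧-identityʳ)
open import Data.Bool.ListAction using (any)
open import Data.Empty using (⊥-elim)
open import Data.Fin using (Fin)
import Data.Fin as Fin
open import Data.Integer using (ℤ; +_; _-_) renaming (_+_ to _+ℤ_; _*_ to _*ℤ_)
import Data.Integer.Properties as ℤ
open import Data.Integer.Tactic.RingSolver using (solve-∀)
open import Data.List using (List; []; _∷_; _++_; [_]; length; filterᵇ; concatMap; map; take; drop; replicate; upTo)
open import Data.List.Properties using (upTo-∷ʳ; map-++; map-cong; ++-assoc; concatMap-++)
open import Data.List.Relation.Unary.All using (All; []; _∷_)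
import Data.List.Relation.Unary.All as All
open import Data.List.Relation.Binary.Permutation.Propositional using (_↭_; ↭-trans; ↭-reflexive)
import Data.List.Relation.Binary.Permutation.Propositional as ↭
open import Data.List.Relation.Binary.Permutation.Propositional.Properties using (shift; ∷↭∷ʳ)
open import Data.Nat using (ℕ; zero; suc; _+_; _*_; _∸_; _<ᵇ_; _≡ᵇ_; _≤_; _<_; z≤n; s≤s; s≤s⁻¹)
open import Data.Nat.ListAction using () renaming (sum to sumL)
open import Data.Nat.ListAction.Properties using (sum-++)
open import Data.Nat.Properties
open import Algebra.Properties.CommutativeSemigroup +-commutativeSemigroup using (interchange)
open import Data.Sum using (inj₁; inj₂)
open import Data.Vec using (Vec; lookup; updateAt; sum; toList)
import Data.Vec as Vec
open import Data.Vec.Properties using (updateAt-id)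
open import Function using (id)
open import Function.Bundles using (Equivalence)
open import Relation.Binary.PropositionalEquality hiding ([_])

T⇒≡true : ∀ {b} → T b → b ≡ true
T⇒≡true = Equivalence.to T-≡

<ᵇ-true : ∀ {m n} → m < n → (m <ᵇ n) ≡ true
<ᵇ-true m<n = T⇒≡true (<⇒<ᵇ m<n)

<ᵇ-false : ∀ {m n} → n ≤ m → (m <ᵇ n) ≡ false
<ᵇ-false {m} {n} n≤m with m <ᵇ n in eq
... | false = refl
... | true  = ⊥-elim (<⇒≱ (<ᵇ⇒< m n (subst T (sym eq) _)) n≤m)

≡ᵇ-false : ∀ {m n} → m ≢ n → (m ≡ᵇ n) ≡ false
≡ᵇ-false {m} {n} m≢n with m ≡ᵇ n in eq
... | false = refl
... | true  = ⊥-elim (m≢n (≡ᵇ⇒≡ m n (subst T (sym eq) _)))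

≡ᵇ-refl : ∀ m → (m ≡ᵇ m) ≡ true
≡ᵇ-refl m = T⇒≡true (≡⇒≡ᵇ m m refl)

≡ᵇ-sym : ∀ m n → (m ≡ᵇ n) ≡ (n ≡ᵇ m)
≡ᵇ-sym zero    zero    = refl
≡ᵇ-sym zero    (suc n) = refl
≡ᵇ-sym (suc m) zero    = refl
≡ᵇ-sym (suc m) (suc n) = ≡ᵇ-sym m n

_∈ᵇ_ : ℕ → List ℕ → Bool
x ∈ᵇ S = any (λ y → x ≡ᵇ y) S

∈ᵇ-above : ∀ m S → All (_< m) S → (m ∈ᵇ S) ≡ false
∈ᵇ-above m []      []         = refl
∈ᵇ-above m (s ∷ S) (s<m ∷ ps) rewrite ≡ᵇ-false {m} {s} (λ m≡s → <-irrefl (sym m≡s) s<m) = ∈ᵇ-above m S ps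

-- (2) Counting filtered lists, and finite sums

cnt : ∀ {A : Set} → (A → Bool) → List A → ℕ
cnt p xs = length (filterᵇ p xs)

cnt-++ : ∀ {A : Set} (p : A → Bool) xs ys → cnt p (xs ++ ys) ≡ cnt p xs + cnt p ys
cnt-++ p []       ys = refl
cnt-++ p (x ∷ xs) ys with p x
... | true  = cong suc (cnt-++ p xs ys)
... | false = cnt-++ p xs ys

cnt-map : ∀ {A B : Set} (p : B → Bool) (f : A → B) xs → cnt p (map f xs) ≡ cnt (λ x → p (f x)) xs
cnt-map p f []       = refl
cnt-map p f (x ∷ xs) with p (f x)
... | true  = cong suc (cnt-map p f xs)
... | false = cnt-map p f xs

cnt-cong : ∀ {A : Set} {p q : A → Bool} xs → (∀ x → p x ≡ q x) → cnt p xs ≡ cnt q xs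
cnt-cong {p = p} {q} []       p≗q = refl
cnt-cong {p = p} {q} (x ∷ xs) p≗q with p x | q x | p≗q x
... | true  | .true  | refl = cong suc (cnt-cong xs p≗q)
... | false | .false | refl = cnt-cong xs p≗q

cnt-false : ∀ {A : Set} {p : A → Bool} xs → (∀ x → p x ≡ false) → cnt p xs ≡ 0
cnt-false {p = p} []       p≗false = refl
cnt-false {p = p} (x ∷ xs) p≗false with p x | p≗false x
... | .false | refl = cnt-false xs p≗false

cnt-singleton : ∀ {A : Set} (p : A → Bool) x → cnt p (x ∷ []) ≡ (if p x then 1 else 0)
cnt-singleton p x with p x
... | true  = refl
... | false = refl

Σ< : ℕ → (ℕ → ℕ) → ℕ
Σ< zero    g = 0
Σ< (suc k) g = Σ< k g + g k

Σ<-upTo : ∀ k g → sumL (map g (upTo k)) ≡ Σ< k g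
Σ<-upTo zero    g = refl
Σ<-upTo (suc k) g = begin
  sumL (map g (upTo (suc k)))        ≡⟨ cong (λ xs → sumL (map g xs)) (sym (upTo-∷ʳ k)) ⟩
  sumL (map g (upTo k ++ [ k ]))     ≡⟨ cong sumL (map-++ g (upTo k) [ k ]) ⟩
  sumL (map g (upTo k) ++ [ g k ])   ≡⟨ sum-++ (map g (upTo k)) [ g k ] ⟩
  sumL (map g (upTo k)) + (g k + 0)  ≡⟨ cong₂ _+_ (Σ<-upTo k g) (+-identityʳ (g k)) ⟩
  Σ< k g + g k                       ∎
  where open ≡-Reasoning

cnt-labellings : ∀ (p : List ℕ → Bool) k N →
  cnt p (labellings k (suc N)) ≡ Σ< k (λ x → cnt (λ l → p (x ∷ l)) (labellings k N))
cnt-labellings p k N = begin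
  cnt p (concatMap (λ x → map (x ∷_) L) (upTo k))             ≡⟨ cnt-concatMap (upTo k) ⟩
  sumL (map (λ x → cnt p (map (x ∷_) L)) (upTo k))           ≡⟨ cong sumL (map-cong (λ x → cnt-map p (x ∷_) L) (upTo k)) ⟩
  sumL (map (λ x → cnt (λ l → p (x ∷ l)) L) (upTo k))        ≡⟨ Σ<-upTo k _ ⟩
  Σ< k (λ x → cnt (λ l → p (x ∷ l)) L)                        ∎
  where
  open ≡-Reasoning
  L = labellings k N
  cnt-concatMap : ∀ xs → cnt p (concatMap (λ x → map (x ∷_) L) xs) ≡ sumL (map (λ x → cnt p (map (x ∷_) L)) xs)
  cnt-concatMap []       = refl
  cnt-concatMap (x ∷ xs) = trans (cnt-++ p (map (x ∷_) L) _) (cong (_+_ (cnt p (map (x ∷_) L))) (cnt-concatMap xs))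

Σ<-cong : ∀ m {f g : ℕ → ℕ} → (∀ x → x < m → f x ≡ g x) → Σ< m f ≡ Σ< m g
Σ<-cong zero    f≗g = refl
Σ<-cong (suc m) f≗g = cong₂ _+_ (Σ<-cong m (λ x x<m → f≗g x (m<n⇒m<1+n x<m))) (f≗g m ≤-refl)

Σ<-+ : ∀ m (f g : ℕ → ℕ) → Σ< m f + Σ< m g ≡ Σ< m (λ x → f x + g x)
Σ<-+ zero    f g = refl
Σ<-+ (suc m) f g =
  trans (interchange (Σ< m f) (f m) (Σ< m g) (g m)) (cong (_+ (f m + g m)) (Σ<-+ m f g))

Σ<-const : ∀ m A → Σ< m (λ _ → A) ≡ m * A
Σ<-const zero    A = refl
Σ<-const (suc m) A = trans (cong (_+ A) (Σ<-const m A)) (+-comm (m * A) A)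

Σ<-single : ∀ m s A → s < m → Σ< m (λ x → if x ≡ᵇ s then A else 0) ≡ A
Σ<-single (suc m) s A s<1+m with m≤n⇒m<n∨m≡n (s≤s⁻¹ s<1+m)
... | inj₁ s<m  rewrite Σ<-single m s A s<m | ≡ᵇ-false {m} {s} (λ m≡s → <-irrefl (sym m≡s) s<m) = +-identityʳ A
... | inj₂ refl rewrite ≡ᵇ-refl s = cong (_+ A) (vanishes s ≤-refl)
  where
  vanishes : ∀ j → j ≤ s → Σ< j (λ x → if x ≡ᵇ s then A else 0) ≡ 0
  vanishes zero    _   = refl
  vanishes (suc j) j<s rewrite vanishes j (<⇒≤ j<s) | ≡ᵇ-false {j} {s} (<⇒≢ j<s) = refl

Σ<-avoid : ∀ m S A → distinct S ≡ true → All (_< m) S →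
  Σ< m (λ x → if x ∈ᵇ S then 0 else A) + length S * A ≡ m * A
Σ<-avoid m []      A _ _ = trans (+-identityʳ _) (Σ<-const m A)
Σ<-avoid m (s ∷ S) A d (s<m ∷ S<m) with s ∈ᵇ S in s∉S
-- (s ∈ᵇ S = true would make d : false ≡ true, so only this case remains)
... | false = begin
  Σ< m g′ + (A + length S * A)       ≡⟨ +-assoc (Σ< m g′) A _ ⟨
  (Σ< m g′ + A) + length S * A       ≡⟨ cong (λ z → (Σ< m g′ + z) + length S * A) (sym (Σ<-single m s A s<m)) ⟩
  (Σ< m g′ + Σ< m ind) + length S * A ≡⟨ cong (_+ length S * A) (trans (Σ<-+ m g′ ind) (Σ<-cong m (λ x _ → merge x))) ⟩
  Σ< m g + length S * A              ≡⟨ Σ<-avoid m S A d S<m ⟩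
  m * A                              ∎
  where
  open ≡-Reasoning
  g g′ ind : ℕ → ℕ
  g   x = if x ∈ᵇ S then 0 else A
  g′  x = if x ∈ᵇ (s ∷ S) then 0 else A
  ind x = if x ≡ᵇ s then A else 0
  merge : ∀ x → g′ x + ind x ≡ g x
  merge x with x ≡ᵇ s in x≡s
  ... | true  rewrite ≡ᵇ⇒≡ x s (subst T (sym x≡s) _) | s∉S = refl
  ... | false = +-identityʳ (g x)

Σ<-support : ∀ {n k} (g : ℕ → ℕ) → n ≤ k → (∀ x → n ≤ x → g x ≡ 0) → Σ< k g ≡ Σ< n g
Σ<-support {k = zero}  g z≤n _ = refl
Σ<-support {k = suc k} g n≤1+k g≡0 with m≤n⇒m<n∨m≡n n≤1+k
... | inj₁ n≤k  = trans (cong₂ _+_ (Σ<-support g (s≤s⁻¹ n≤k) g≡0) (g≡0 k (s≤s⁻¹ n≤k))) (+-identityʳ _)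
... | inj₂ refl = refl

-- Evaluation of the first-label sum arising in the counting step: labels below m are
-- worth A unless they lie in S, label m (a new block, if m < k) is worth B, larger
-- labels are worth nothing.
Σ<-firstLabel : ∀ {k m A B} S (g : ℕ → ℕ) → m ≤ k → distinct S ≡ true → All (_< m) S →
  (∀ x → x < m → g x ≡ (if x ∈ᵇ S then 0 else A)) →
  (m < k → g m ≡ B) → (m ≡ k → B ≡ 0) → (∀ x → m < x → g x ≡ 0) →
  Σ< k g ≡ B + (m ∸ length S) * A
Σ<-firstLabel {k} {m} {A} {B} S g m≤k d S<m below new new≡0 above = begin
  Σ< k g                       ≡⟨ upToNew ⟩
  Σ< m g + B                   ≡⟨ cong (_+ B) (trans (Σ<-cong m below) old-blocks) ⟩
  (m ∸ length S) * A + B       ≡⟨ +-comm _ B ⟩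
  B + (m ∸ length S) * A       ∎
  where
  open ≡-Reasoning
  old-blocks : Σ< m (λ x → if x ∈ᵇ S then 0 else A) ≡ (m ∸ length S) * A
  old-blocks = begin
    Σ< m _                                       ≡⟨ m+n∸n≡m _ (length S * A) ⟨
    (Σ< m _ + length S * A) ∸ length S * A       ≡⟨ cong (_∸ length S * A) (Σ<-avoid m S A d S<m) ⟩
    m * A ∸ length S * A                         ≡⟨ *-distribʳ-∸ A m (length S) ⟨
    (m ∸ length S) * A                           ∎
  upToNew : Σ< k g ≡ Σ< m g + B
  upToNew with m≤n⇒m<n∨m≡n m≤k
  ... | inj₁ m<k  = trans (Σ<-support g m<k above) (cong (_+_ (Σ< m g)) (new m<k))
  ... | inj₂ m≡k rewrite new≡0 m≡k | m≡k = sym (+-identityʳ _)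

-- (3) A left-to-right reading of the admissibility test

restrOKL : List ℕ → List ℕ → Bool
restrOKL []       l = true
restrOKL (r ∷ rs) l = distinct (take r l) ∧ restrOKL rs (drop r l)

restrOK-toList : ∀ {p} (r : Vec ℕ p) l → restrOK r l ≡ restrOKL (toList r) l
restrOK-toList Vec.[]       l = refl
restrOK-toList (r Vec.∷ rs) l = cong (distinct (take r l) ∧_) (restrOK-toList rs (drop r l))

restrOKL-[] : ∀ rs → restrOKL rs [] ≡ true
restrOKL-[] []           = refl
restrOKL-[] (zero ∷ rs)  = restrOKL-[] rs
restrOKL-[] (suc r ∷ rs) = restrOKL-[] rs

avoids : List ℕ → List ℕ → Bool
avoids S []       = true
avoids S (x ∷ xs) = not (x ∈ᵇ S) ∧ avoids S xs

avoids-[] : ∀ xs → avoids [] xs ≡ true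
avoids-[] []       = refl
avoids-[] (x ∷ xs) = avoids-[] xs

avoids-∷ : ∀ x S xs → avoids (x ∷ S) xs ≡ not (x ∈ᵇ xs) ∧ avoids S xs
avoids-∷ x S []       = refl
avoids-∷ x S (y ∷ xs) rewrite avoids-∷ x S xs | ≡ᵇ-sym y x = swap-∨ (x ≡ᵇ y) (y ∈ᵇ S) (x ∈ᵇ xs) (avoids S xs)
  where
  swap-∨ : ∀ a b c d → not (a ∨ b) ∧ (not c ∧ d) ≡ not (a ∨ c) ∧ (not b ∧ d)
  swap-∨ true  b     c     d = refl
  swap-∨ false true  true  d = refl
  swap-∨ false true  false d = refl
  swap-∨ false false c     d = refl

∧-regroup : ∀ g a b c d e → g ∧ ((a ∧ b) ∧ ((c ∧ d) ∧ e)) ≡ a ∧ (g ∧ ((c ∧ b) ∧ (d ∧ e)))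
∧-regroup false false b     c     d e = refl
∧-regroup false true  b     c     d e = refl
∧-regroup true  false b     c     d e = refl
∧-regroup true  true  false false d e = refl
∧-regroup true  true  false true  d e = refl
∧-regroup true  true  true  false d e = refl
∧-regroup true  true  true  true  d e = refl

module Admissible (k : ℕ) where

  -- admissible m S c rs l: the labels l, read left to right, continue a restricted growth
  -- string that has opened m of the k blocks, while the current restricted group has c
  -- members still to come, its earlier members used the labels S, and groups of sizes rs
  -- follow; after the last group the elements are unrestricted.
  admissible : ℕ → List ℕ → ℕ → List ℕ → List ℕ → Bool
  admissible m S zero    (r ∷ rs) l       = admissible m [] r rs l
  admissible m S zero    []       l       = rgs k m l
  admissible m S (suc c) rs       []      = m ≡ᵇ k
  admissible m S (suc c) rs       (x ∷ l) =
    if x <ᵇ m then not (x ∈ᵇ S) ∧ admissible m (x ∷ S) c rs l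
    else (if x ≡ᵇ m then not (x ∈ᵇ S) ∧ admissible (suc m) (x ∷ S) c rs l else false)

  groupsOK : List ℕ → ℕ → List ℕ → List ℕ → Bool
  groupsOK S c rs l = avoids S (take c l) ∧ (distinct (take c l) ∧ restrOKL rs (drop c l))

  admissible-correct : ∀ m S c rs l → rgs k m l ∧ groupsOK S c rs l ≡ admissible m S c rs l
  admissible-correct m S zero (r ∷ rs) l =
    trans (cong (λ b → rgs k m l ∧ (b ∧ (distinct (take r l) ∧ restrOKL rs (drop r l)))) (sym (avoids-[] (take r l))))
          (admissible-correct m [] r rs l)
  admissible-correct m S zero    []  l = ∧-identityʳ _
  admissible-correct m S (suc c) rs [] rewrite restrOKL-[] rs = ∧-identityʳ _
  admissible-correct m S (suc c) rs (x ∷ l) with x <ᵇ m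
  ... | true  rewrite sym (admissible-correct m (x ∷ S) c rs l) | avoids-∷ x S (take c l) =
    ∧-regroup (rgs k m l) (not (x ∈ᵇ S)) (avoids S (take c l)) (not (x ∈ᵇ take c l)) (distinct (take c l)) _
  ... | false with x ≡ᵇ m
  ... | true  rewrite sym (admissible-correct (suc m) (x ∷ S) c rs l) | avoids-∷ x S (take c l) =
    ∧-regroup (rgs k (suc m) l) (not (x ∈ᵇ S)) (avoids S (take c l)) (not (x ∈ᵇ take c l)) (distinct (take c l)) _
  ... | false = refl

  admissible-[] : ∀ m S c rs → admissible m S c rs [] ≡ (m ≡ᵇ k)
  admissible-[] m S zero    (r ∷ rs) = admissible-[] m [] r rs
  admissible-[] m S zero    []       = refl
  admissible-[] m S (suc c) rs       = refl

  rgs-below : ∀ {m x} l → x < m → rgs k m (x ∷ l) ≡ rgs k m l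
  rgs-below l x<m rewrite <ᵇ-true x<m = refl

  rgs-new : ∀ {m} l → rgs k m (m ∷ l) ≡ rgs k (suc m) l
  rgs-new {m} l rewrite <ᵇ-false {m} {m} ≤-refl | ≡ᵇ-refl m = refl

  rgs-above : ∀ {m x} l → m < x → rgs k m (x ∷ l) ≡ false
  rgs-above {m} {x} l m<x rewrite <ᵇ-false (<⇒≤ m<x) | ≡ᵇ-false {x} {m} (>⇒≢ m<x) = refl

  step-below : ∀ {m S c rs x} l → x < m →
    admissible m S (suc c) rs (x ∷ l) ≡ not (x ∈ᵇ S) ∧ admissible m (x ∷ S) c rs l
  step-below l x<m rewrite <ᵇ-true x<m = refl

  step-new : ∀ {m S c rs} l →
    admissible m S (suc c) rs (m ∷ l) ≡ not (m ∈ᵇ S) ∧ admissible (suc m) (m ∷ S) c rs l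
  step-new {m} l rewrite <ᵇ-false {m} {m} ≤-refl | ≡ᵇ-refl m = refl

  step-above : ∀ {m S c rs x} l → m < x → admissible m S (suc c) rs (x ∷ l) ≡ false
  step-above {m} {x = x} l m<x rewrite <ᵇ-false (<⇒≤ m<x) | ≡ᵇ-false {x} {m} (>⇒≢ m<x) = refl

  -- (4) The number of admissible labellings, as a recursion on the length N

  -- count N m j c rs mirrors 'admissible' with the used-label set S replaced by its size j:
  -- a restricted element may join m - j open blocks or open a new one.
  count : ℕ → ℕ → ℕ → ℕ → List ℕ → ℕ
  count zero    m j c       rs       = if m ≡ᵇ k then 1 else 0
  count (suc N) m j zero    (r ∷ rs) = count (suc N) m 0 r rs
  count (suc N) m j zero    []       = count N (suc m) 0 0 [] + m * count N m 0 0 []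
  count (suc N) m j (suc c) rs       = count N (suc m) (suc j) c rs + (m ∸ j) * count N m (suc j) c rs

  count-vanishes : ∀ N m j c rs → k < m → count N m j c rs ≡ 0
  count-vanishes zero    m j c rs k<m rewrite ≡ᵇ-false {m} {k} (>⇒≢ k<m) = refl
  count-vanishes (suc N) m j zero (r ∷ rs) k<m = count-vanishes (suc N) m 0 r rs k<m
  count-vanishes (suc N) m j zero [] k<m
    rewrite count-vanishes N (suc m) 0 0 [] (m<n⇒m<1+n k<m) | count-vanishes N m 0 0 [] k<m = *-zeroʳ m
  count-vanishes (suc N) m j (suc c) rs k<m
    rewrite count-vanishes N (suc m) (suc j) c rs (m<n⇒m<1+n k<m) | count-vanishes N m (suc j) c rs k<m = *-zeroʳ (m ∸ j)

  count-admissible : ∀ N m S c rs → m ≤ k → distinct S ≡ true → All (_< m) S →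
    cnt (admissible m S c rs) (labellings k N) ≡ count N m (length S) c rs
  count-admissible zero m S c rs _ _ _ =
    trans (cnt-singleton (admissible m S c rs) []) (cong (λ b → if b then 1 else 0) (admissible-[] m S c rs))
  count-admissible (suc N) m S zero (r ∷ rs) m≤k _ _ = count-admissible (suc N) m [] r rs m≤k refl []
  count-admissible (suc N) m S zero [] m≤k _ _ =
    trans (cnt-labellings (rgs k m) k N)
      (Σ<-firstLabel [] _ m≤k refl [] below new (λ m≡k → count-vanishes N (suc m) 0 0 [] (s≤s (≤-reflexive (sym m≡k)))) above)
    where
    L = labellings k N
    below : ∀ x → x < m → cnt (λ l → rgs k m (x ∷ l)) L ≡ count N m 0 0 []
    below x x<m = trans (cnt-cong L (λ l → rgs-below l x<m)) (count-admissible N m [] 0 [] m≤k refl [])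
    new : m < k → cnt (λ l → rgs k m (m ∷ l)) L ≡ count N (suc m) 0 0 []
    new m<k = trans (cnt-cong L rgs-new) (count-admissible N (suc m) [] 0 [] m<k refl [])
    above : ∀ x → m < x → cnt (λ l → rgs k m (x ∷ l)) L ≡ 0
    above x m<x = cnt-false L (λ l → rgs-above l m<x)
  count-admissible (suc N) m S (suc c) rs m≤k d S<m =
    trans (cnt-labellings (admissible m S (suc c) rs) k N)
      (Σ<-firstLabel S _ m≤k d S<m below new (λ m≡k → count-vanishes N (suc m) _ c rs (s≤s (≤-reflexive (sym m≡k)))) above)
    where
    L = labellings k N
    below : ∀ x → x < m → cnt (λ l → admissible m S (suc c) rs (x ∷ l)) L
                          ≡ (if x ∈ᵇ S then 0 else count N m (suc (length S)) c rs)
    below x x<m = trans (cnt-cong L (λ l → step-below {m} {S} {c} {rs} l x<m)) (byMembership (x ∈ᵇ S) refl)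
      where
      byMembership : ∀ b → (x ∈ᵇ S) ≡ b → cnt (λ l → not b ∧ admissible m (x ∷ S) c rs l) L
                                          ≡ (if b then 0 else count N m (suc (length S)) c rs)
      byMembership true  _   = cnt-false L (λ _ → refl)
      byMembership false x∉S =
        count-admissible N m (x ∷ S) c rs m≤k (trans (cong (λ b → not b ∧ distinct S) x∉S) d) (x<m ∷ S<m)
    new : m < k → cnt (λ l → admissible m S (suc c) rs (m ∷ l)) L ≡ count N (suc m) (suc (length S)) c rs
    new m<k = trans (cnt-cong L (λ l → trans (step-new {m} {S} {c} {rs} l)
                                             (cong (λ b → not b ∧ admissible (suc m) (m ∷ S) c rs l) m∉S)))
                    (count-admissible N (suc m) (m ∷ S) c rs m<k (trans (cong (λ b → not b ∧ distinct S) m∉S) d)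
                                      (≤-refl ∷ All.map m<n⇒m<1+n S<m))
      where m∉S = ∈ᵇ-above m S S<m
    above : ∀ x → m < x → cnt (λ l → admissible m S (suc c) rs (x ∷ l)) L ≡ 0
    above x m<x = cnt-false L (λ l → step-above {m} {S} {c} {rs} l m<x)

open Admissible using (admissible-correct; count; count-admissible)

-- (5) The signed weight of a list of forbidden counts

-- W as m k: ways to place the elements of a list, an element with forbidden count a
-- joining one of m - a open blocks or opening a new one, starting from m open blocks and
-- ending with exactly k.  Taken over ℤ so that arbitrary reorderings make sense.
W : List ℕ → ℕ → ℕ → ℤ
W []       m k = + (if m ≡ᵇ k then 1 else 0)
W (a ∷ as) m k = W as (suc m) k +ℤ (+ m - + a) *ℤ W as m k

W-swap : ∀ a b zs m k → W (a ∷ b ∷ zs) m k ≡ W (b ∷ a ∷ zs) m k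
W-swap a b zs m k rewrite ℤ.pos-+ 1 m =
  exchange (+ m) (+ a) (+ b) (W zs (suc (suc m)) k) (W zs (suc m) k) (W zs m k)
  where
  exchange : ∀ (M A B X₂ X₁ X₀ : ℤ) →
    X₂ +ℤ ((+ 1 +ℤ M) - B) *ℤ X₁ +ℤ (M - A) *ℤ (X₁ +ℤ (M - B) *ℤ X₀) ≡
    X₂ +ℤ ((+ 1 +ℤ M) - A) *ℤ X₁ +ℤ (M - B) *ℤ (X₁ +ℤ (M - A) *ℤ X₀)
  exchange = solve-∀

W-↭ : ∀ {xs ys} → xs ↭ ys → ∀ m k → W xs m k ≡ W ys m k
W-↭ ↭.refl m k = refl
W-↭ (↭.prep x p) m k = cong₂ (λ u v → u +ℤ (+ m - + x) *ℤ v) (W-↭ p (suc m) k) (W-↭ p m k)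
W-↭ (↭.swap {xs} x y p) m k = trans (W-swap x y xs m k)
  (cong₂ (λ u v → u +ℤ (+ m - + y) *ℤ v)
     (cong₂ (λ u v → u +ℤ (+ suc m - + x) *ℤ v) (W-↭ p (suc (suc m)) k) (W-↭ p (suc m) k))
     (cong₂ (λ u v → u +ℤ (+ m - + x) *ℤ v) (W-↭ p (suc m) k) (W-↭ p m k)))
W-↭ (↭.trans p q) m k = trans (W-↭ p m k) (W-↭ q m k)

-- W with target k - 1 (and 0 for target 0): the count before a block-opening last element.
Wprev : List ℕ → ℕ → ℕ → ℤ
Wprev xs m zero    = + 0
Wprev xs m (suc k) = W xs m k

Wprev-∷ : ∀ x xs m k → Wprev (x ∷ xs) m k ≡ Wprev xs (suc m) k +ℤ (+ m - + x) *ℤ Wprev xs m k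
Wprev-∷ x xs m zero    = sym (trans (ℤ.+-identityˡ _) (ℤ.*-zeroʳ (+ m - + x)))
Wprev-∷ x xs m (suc k) = refl

-- The last element either opens the k-th block or joins one of k - a blocks.
W-∷ʳ : ∀ xs a m k → W (xs ++ [ a ]) m k ≡ Wprev xs m k +ℤ (+ k - + a) *ℤ W xs m k
W-∷ʳ []       a m k = cong₂ _+ℤ_ (last-opens k) last-joins
  where
  last-opens : ∀ k → W [] (suc m) k ≡ Wprev [] m k
  last-opens zero    = refl
  last-opens (suc k) = refl
  last-joins : (+ m - + a) *ℤ W [] m k ≡ (+ k - + a) *ℤ W [] m k
  last-joins with m ≡ᵇ k in m≡k
  ... | true  rewrite ≡ᵇ⇒≡ m k (subst T (sym m≡k) _) = refl
  ... | false = trans (ℤ.*-zeroʳ (+ m - + a)) (sym (ℤ.*-zeroʳ (+ k - + a)))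
W-∷ʳ (x ∷ xs) a m k rewrite W-∷ʳ xs a (suc m) k | W-∷ʳ xs a m k | Wprev-∷ x xs m k =
  distribute (Wprev xs (suc m) k) (Wprev xs m k) (W xs (suc m) k) (W xs m k) (+ k - + a) (+ m - + x)
  where
  distribute : ∀ (P₁ P₀ Q₁ Q₀ C D : ℤ) →
    (P₁ +ℤ C *ℤ Q₁) +ℤ D *ℤ (P₀ +ℤ C *ℤ Q₀) ≡ (P₁ +ℤ D *ℤ P₀) +ℤ C *ℤ (Q₁ +ℤ D *ℤ Q₀)
  distribute = solve-∀

-- (6) The Stirling number as the weight of a list of forbidden counts

-- rangeFrom j c = j, j+1, …, j+c-1: the forbidden counts along (the rest of) a group.
rangeFrom : ℕ → ℕ → List ℕ
rangeFrom j zero    = []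
rangeFrom j (suc c) = j ∷ rangeFrom (suc j) c

rangeFrom-∷ʳ : ∀ j t → rangeFrom j (suc t) ≡ rangeFrom j t ++ [ j + t ]
rangeFrom-∷ʳ j zero    = cong [_] (sym (+-identityʳ j))
rangeFrom-∷ʳ j (suc t) = cong (j ∷_) (trans (rangeFrom-∷ʳ (suc j) t) (cong (λ z → rangeFrom (suc j) t ++ [ z ]) (sym (+-suc j t))))

-- The forbidden counts of N elements in the order 'count' reads them: the current group
-- continues from j with c members left, then come the groups rs, then unrestricted
-- elements (forbidden count 0).
forbiddenFrom : ℕ → ℕ → List ℕ → ℕ → List ℕ
forbiddenFrom j c       rs       zero    = []
forbiddenFrom j zero    (r ∷ rs) (suc N) = forbiddenFrom 0 r rs (suc N)
forbiddenFrom j zero    []       (suc N) = 0 ∷ forbiddenFrom 0 0 [] N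
forbiddenFrom j (suc c) rs       (suc N) = j ∷ forbiddenFrom (suc j) c rs N

-- One step of 'count' is one step of W, since + (m ∸ j) = + m - + j for j ≤ m.
W-step : ∀ {m j k A B} L → j ≤ m → (j < m → + A ≡ W L m k) → + B ≡ W L (suc m) k →
  + (B + (m ∸ j) * A) ≡ W (j ∷ L) m k
W-step {m} {j} {k} {A} {B} L j≤m A≡ B≡ =
  trans (ℤ.pos-+ B ((m ∸ j) * A)) (cong₂ _+ℤ_ B≡ joins)
  where
  joins : + ((m ∸ j) * A) ≡ (+ m - + j) *ℤ W L m k
  joins with m≤n⇒m<n∨m≡n j≤m
  ... | inj₁ j<m  = trans (ℤ.pos-* (m ∸ j) A)
                          (cong₂ _*ℤ_ (trans (sym (ℤ.⊖-≥ j≤m)) (sym (ℤ.m-n≡m⊖n m j))) (A≡ j<m))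
  ... | inj₂ refl rewrite n∸n≡0 j | ℤ.+-inverseʳ (+ j) = refl

count-W : ∀ k N m j c rs → j ≤ m → + count k N m j c rs ≡ W (forbiddenFrom j c rs N) m k
count-W k zero    m j c       rs       j≤m = refl
count-W k (suc N) m j zero    (r ∷ rs) j≤m = count-W k (suc N) m 0 r rs z≤n
count-W k (suc N) m j zero    []       j≤m =
  W-step (forbiddenFrom 0 0 [] N) z≤n (λ _ → count-W k N m 0 0 [] z≤n) (count-W k N (suc m) 0 0 [] z≤n)
count-W k (suc N) m j (suc c) rs       j≤m =
  W-step (forbiddenFrom (suc j) c rs N) j≤m (count-W k N m (suc j) c rs) (count-W k N (suc m) (suc j) c rs (s≤s j≤m))

prescription : List ℕ → ℕ → List ℕ
prescription rs N = concatMap (rangeFrom 0) rs ++ replicate (N ∸ sumL rs) 0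

empty-groups : ∀ rs → sumL rs ≡ 0 → concatMap (rangeFrom 0) rs ≡ []
empty-groups []          _   = refl
empty-groups (zero ∷ rs) s≡0 = empty-groups rs s≡0

forbiddenFrom-closed : ∀ j c rs N → c + sumL rs ≤ N →
  forbiddenFrom j c rs N ≡ rangeFrom j c ++ concatMap (rangeFrom 0) rs ++ replicate (N ∸ (c + sumL rs)) 0
forbiddenFrom-closed j zero rs zero s≤0 rewrite n≤0⇒n≡0 s≤0 | empty-groups rs (n≤0⇒n≡0 s≤0) = refl
forbiddenFrom-closed j zero (r ∷ rs) (suc N) s≤N =
  trans (forbiddenFrom-closed 0 r rs (suc N) s≤N) (sym (++-assoc (rangeFrom 0 r) (concatMap (rangeFrom 0) rs) _))
forbiddenFrom-closed j zero    []  (suc N) _   = cong (0 ∷_) (forbiddenFrom-closed 0 0 [] N z≤n)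
forbiddenFrom-closed j (suc c) rs  (suc N) s≤N = cong (j ∷_) (forbiddenFrom-closed (suc j) c rs N (s≤s⁻¹ s≤N))

sum-toList : ∀ {p} (r : Vec ℕ p) → sumL (toList r) ≡ sum r
sum-toList Vec.[]      = refl
sum-toList (x Vec.∷ r) = cong (_+_ x) (sum-toList r)

stirling-W : ∀ {p} (r : Vec ℕ p) N k → sum r ≤ N → + stirlingR r N k ≡ W (prescription (toList r) N) 0 k
stirling-W r N k |r|≤N rewrite T⇒≡true (≤⇒≤ᵇ |r|≤N) = begin
  + cnt (λ l → rgs k 0 l ∧ restrOK r l) (labellings k N)
    ≡⟨ cong +_ (cnt-cong (labellings k N) sequential) ⟩
  + cnt (Admissible.admissible k 0 [] 0 (toList r)) (labellings k N)
    ≡⟨ cong +_ (count-admissible k N 0 [] 0 (toList r) z≤n refl []) ⟩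
  + count k N 0 0 0 (toList r)
    ≡⟨ count-W k N 0 0 0 (toList r) z≤n ⟩
  W (forbiddenFrom 0 0 (toList r) N) 0 k
    ≡⟨ cong (λ xs → W xs 0 k) (forbiddenFrom-closed 0 0 (toList r) N (subst (_≤ N) (sym (sum-toList r)) |r|≤N)) ⟩
  W (prescription (toList r) N) 0 k ∎
  where
  open ≡-Reasoning
  sequential : ∀ l → rgs k 0 l ∧ restrOK r l ≡ Admissible.admissible k 0 [] 0 (toList r) l
  sequential l = trans (cong (rgs k 0 l ∧_) (restrOK-toList r l)) (admissible-correct k 0 [] 0 (toList r) l)

-- (7) Moving the last member of the i-th group to the end

move-to-end : ∀ xs (t : ℕ) ys → xs ++ t ∷ ys ↭ (xs ++ ys) ++ [ t ]
move-to-end xs t ys = ↭-trans (shift t xs ys) (∷↭∷ʳ t (xs ++ ys))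

sumL-bump : ∀ A t B → sumL (A ++ suc t ∷ B) ≡ suc (sumL (A ++ t ∷ B))
sumL-bump A t B = begin
  sumL (A ++ suc t ∷ B)       ≡⟨ sum-++ A (suc t ∷ B) ⟩
  sumL A + suc (sumL (t ∷ B)) ≡⟨ +-suc (sumL A) (sumL (t ∷ B)) ⟩
  suc (sumL A + sumL (t ∷ B)) ≡⟨ cong suc (sum-++ A (t ∷ B)) ⟨
  suc (sumL (A ++ t ∷ B))     ∎
  where open ≡-Reasoning

prescription-bump : ∀ A t B n → prescription (A ++ suc t ∷ B) (suc n) ↭ prescription (A ++ t ∷ B) n ++ [ t ]
prescription-bump A t B n rewrite sumL-bump A t B =
  ↭-trans (↭-reflexive with-t) (↭-trans (move-to-end (CA ++ R) t (CB ++ Z)) (↭-reflexive (cong (_++ [ t ]) (sym without-t))))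
  where
  open ≡-Reasoning
  C : List ℕ → List ℕ
  C = concatMap (rangeFrom 0)
  CA = C A
  CB = C B
  R = rangeFrom 0 t
  Z = replicate (n ∸ sumL (A ++ t ∷ B)) 0
  with-t : C (A ++ suc t ∷ B) ++ Z ≡ (CA ++ R) ++ t ∷ (CB ++ Z)
  with-t = begin
    C (A ++ suc t ∷ B) ++ Z         ≡⟨ cong (_++ Z) (concatMap-++ (rangeFrom 0) A (suc t ∷ B)) ⟩
    (CA ++ (rangeFrom 0 (suc t) ++ CB)) ++ Z ≡⟨ cong (λ u → (CA ++ (u ++ CB)) ++ Z) (rangeFrom-∷ʳ 0 t) ⟩
    (CA ++ ((R ++ [ t ]) ++ CB)) ++ Z ≡⟨ ++-assoc CA _ Z ⟩
    CA ++ (((R ++ [ t ]) ++ CB) ++ Z) ≡⟨ cong (CA ++_) (trans (++-assoc (R ++ [ t ]) CB Z) (++-assoc R [ t ] (CB ++ Z))) ⟩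
    CA ++ (R ++ t ∷ (CB ++ Z))        ≡⟨ ++-assoc CA R _ ⟨
    (CA ++ R) ++ t ∷ (CB ++ Z)        ∎
  without-t : C (A ++ t ∷ B) ++ Z ≡ (CA ++ R) ++ (CB ++ Z)
  without-t = begin
    C (A ++ t ∷ B) ++ Z         ≡⟨ cong (_++ Z) (concatMap-++ (rangeFrom 0) A (t ∷ B)) ⟩
    (CA ++ (R ++ CB)) ++ Z      ≡⟨ ++-assoc CA _ Z ⟩
    CA ++ ((R ++ CB) ++ Z)      ≡⟨ cong (CA ++_) (++-assoc R CB Z) ⟩
    CA ++ (R ++ (CB ++ Z))      ≡⟨ ++-assoc CA R _ ⟨
    (CA ++ R) ++ (CB ++ Z)      ∎

entriesBefore : ∀ {p} → Vec ℕ p → Fin p → List ℕ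
entriesBefore (x Vec.∷ xs) Fin.zero    = []
entriesBefore (x Vec.∷ xs) (Fin.suc i) = x ∷ entriesBefore xs i

entriesAfter : ∀ {p} → Vec ℕ p → Fin p → List ℕ
entriesAfter (x Vec.∷ xs) Fin.zero    = toList xs
entriesAfter (x Vec.∷ xs) (Fin.suc i) = entriesAfter xs i

toList-updateAt : ∀ {p} (r : Vec ℕ p) i f →
  toList (updateAt r i f) ≡ entriesBefore r i ++ f (lookup r i) ∷ entriesAfter r i
toList-updateAt (x Vec.∷ xs) Fin.zero    f = refl
toList-updateAt (x Vec.∷ xs) (Fin.suc i) f = cong (x ∷_) (toList-updateAt xs i f)

coefficient : ∀ k t → + (k + 1) - + suc t ≡ + k - + t
coefficient k t = trans (cong₂ _-_ (ℤ.pos-+ k 1) (ℤ.pos-+ 1 t)) (cancel (+ k) (+ t))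
  where
  cancel : ∀ (K T : ℤ) → (K +ℤ + 1) - (+ 1 +ℤ T) ≡ K - T
  cancel = solve-∀

recurrence : ∀ {p} (r : Vec ℕ p) (i : Fin p) t → lookup r i ≡ suc t → ∀ n k → sum r ≤ n →
  + stirlingR r n k ≡
    (+ (case-k k (λ k′ → stirlingR (updateAt r i (_∸ 1)) (n ∸ 1) k′)))
    +ℤ ((+ (k + 1) - + lookup r i) *ℤ + stirlingR (updateAt r i (_∸ 1)) (n ∸ 1) k)
recurrence r i t rᵢ≡1+t n k |r|≤n = byLength n |r|≤n
  where
  A = entriesBefore r i
  B = entriesAfter r i
  r′ = updateAt r i (_∸ 1)
  r-groups : toList r ≡ A ++ suc t ∷ B
  r-groups = begin
    toList r                               ≡⟨ cong toList (updateAt-id i r) ⟨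
    toList (updateAt r i id)               ≡⟨ toList-updateAt r i id ⟩
    A ++ lookup r i ∷ B                    ≡⟨ cong (λ z → A ++ z ∷ B) rᵢ≡1+t ⟩
    A ++ suc t ∷ B                         ∎
    where open ≡-Reasoning
  r′-groups : toList r′ ≡ A ++ t ∷ B
  r′-groups = trans (toList-updateAt r i (_∸ 1)) (cong (λ z → A ++ (z ∸ 1) ∷ B) rᵢ≡1+t)
  |r|≡1+|r′| : sum r ≡ suc (sum r′)
  |r|≡1+|r′| = begin
    sum r                     ≡⟨ sum-toList r ⟨
    sumL (toList r)           ≡⟨ cong sumL r-groups ⟩
    sumL (A ++ suc t ∷ B)     ≡⟨ sumL-bump A t B ⟩
    suc (sumL (A ++ t ∷ B))   ≡⟨ cong (λ xs → suc (sumL xs)) r′-groups ⟨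
    suc (sumL (toList r′))    ≡⟨ cong suc (sum-toList r′) ⟩
    suc (sum r′)              ∎
    where open ≡-Reasoning
  r′-W : ∀ n k′ → sum r′ ≤ n → W (prescription (A ++ t ∷ B) n) 0 k′ ≡ + stirlingR r′ n k′
  r′-W n k′ |r′|≤n = sym (trans (stirling-W r′ n k′ |r′|≤n) (cong (λ xs → W (prescription xs n) 0 k′) r′-groups))
  Goal : ℕ → Set
  Goal n = + stirlingR r n k ≡
    (+ (case-k k (λ k′ → stirlingR r′ (n ∸ 1) k′))) +ℤ ((+ (k + 1) - + lookup r i) *ℤ + stirlingR r′ (n ∸ 1) k)
  byLength : ∀ n → sum r ≤ n → Goal n
  byLength zero |r|≤0 with subst (_≤ 0) |r|≡1+|r′| |r|≤0
  ... | ()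
  byLength (suc n) |r|≤1+n = begin
    + stirlingR r (suc n) k                        ≡⟨ stirling-W r (suc n) k |r|≤1+n ⟩
    W (prescription (toList r) (suc n)) 0 k        ≡⟨ cong (λ xs → W (prescription xs (suc n)) 0 k) r-groups ⟩
    W (prescription (A ++ suc t ∷ B) (suc n)) 0 k  ≡⟨ W-↭ (prescription-bump A t B n) 0 k ⟩
    W (X ++ [ t ]) 0 k                             ≡⟨ W-∷ʳ X t 0 k ⟩
    Wprev X 0 k +ℤ (+ k - + t) *ℤ W X 0 k          ≡⟨ cong₂ _+ℤ_ (opens k) (cong₂ _*ℤ_ coeff (r′-W n k |r′|≤n)) ⟩
    + case-k k (λ k′ → stirlingR r′ n k′) +ℤ (+ (k + 1) - + lookup r i) *ℤ + stirlingR r′ n k ∎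
    where
    open ≡-Reasoning
    X = prescription (A ++ t ∷ B) n
    |r′|≤n : sum r′ ≤ n
    |r′|≤n = s≤s⁻¹ (subst (_≤ suc n) |r|≡1+|r′| |r|≤1+n)
    coeff : + k - + t ≡ + (k + 1) - + lookup r i
    coeff = sym (trans (cong (λ z → + (k + 1) - + z) rᵢ≡1+t) (coefficient k t))
    opens : ∀ k → Wprev X 0 k ≡ + case-k k (λ k′ → stirlingR r′ n k′)
    opens zero    = refl
    opens (suc k) = r′-W n k |r′|≤n

mainTheorem4 : (p : ℕ) → 1 ≤ p → (r : Vec ℕ p) → (n k : ℕ) → sum r ≤ n →
    (i : Fin p) → 1 ≤ lookup r i →
    + stirlingR r n k ≡
      (+ (case-k k (λ k′ → stirlingR (updateAt r i (_∸ 1)) (n ∸ 1) k′)))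
      +ℤ ((+ (k + 1) - + lookup r i) *ℤ + stirlingR (updateAt r i (_∸ 1)) (n ∸ 1) k)
mainTheorem4 p _ r n k |r|≤n i 1≤rᵢ = recurrence r i (lookup r i ∸ 1) (sym (m+[n∸m]≡n 1≤rᵢ)) n k |r|≤n
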